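{- Let $n=2^r$. If a sequence in $\mathbb{Z}_{n}$ is an $E$-extremal sequence for $U(n)$, then it is $U(n)$-equivalent to a sequence in which $2^i$ occurs exactly once for each $i\in[0,r-2]$, there is an odd number $m\in[1,2^r-1]$ such that $2^{r-1}$ occurs exactly $m$ times, and all remaining terms are zero.
   Context: $\mathbb{Z}_n=\mathbb{Z}/n\mathbb{Z}$ and $U(n)$ is its unit group. For $A\subseteq\mathbb{Z}_n$, an $A$-weighted zero-sum subsequence of a sequence $(x_1,\ldots,x_k)$ is given by a non-empty $I\subseteq[1,k]$ and $a_i\in A$ ($i\in I$) with $\sum_{i\in I}a_ix_i=0$; its length is $|I|$. $E_A(n)$ is the least positive integer $k$ such that every sequence of length $k$ in $\mathbb{Z}_n$ has an $A$-weighted zero-sum subsequence of length $n$. An $E$-extremal sequence for $A$ is a sequence of length $E_A(n)-1$ in $\mathbb{Z}_n$ with no $A$-weighted zero-sum subsequence of length $n$. For a subgroup $A$ of $U(n)$, sequences $S=(x_1,\ldots,x_k)$ and $T=(y_1,\ldots,y_k)$ in $\mathbb{Z}_n$ are $A$-equivalent if there exist $c\in U(n)$, a permutation $\sigma$ of $[1,k]$ and $a_1,\ldots,a_k\in A$ with $c\,y_{\sigma(i)}=a_ix_i$ for all $i$. (It is known that $E_{U(n)}(n)=n+\Omega(n)$, so $E_{U(2^r)}(2^r)=2^r+r$.) -}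

module Defs where

open import Data.Nat using (ℕ; zero; suc; _+_; _*_; _∸_; _^_; _≤_; _<_; _≡ᵇ_)
open import Data.Nat.Divisibility using (_∣_)
open import Data.Nat.Coprimality using (Coprime)
open import Data.Bool using (Bool; true; false; if_then_else_)
open import Data.Empty using (⊥)
open import Data.Fin using (Fin; toℕ) renaming (zero to fzero; suc to fsuc)
open import Data.Fin.Subset using (Subset; ∣_∣; Nonempty)
open import Data.Fin.Permutation using (Permutation′; _⟨$⟩ʳ_)
open import Data.Vec using ([]; _∷_)
open import Data.Product using (Σ; Σ-syntax; _×_; proj₁)
open import Relation.Binary.PropositionalEquality using (_≡_)
open import Function using (_∘_)

-- Z_n is represented by Fin n (residues 0..n-1); products are computed on
-- representatives in ℕ, and equality in Z_n is congruence mod n.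
_≡[mod_]_ : ℕ → ℕ → ℕ → Set
a ≡[mod n ] b = Σ[ t ∈ ℕ ] Σ[ s ∈ ℕ ] (a + t * n ≡ b + s * n)

U : ℕ → Set
U n = Σ[ a ∈ Fin n ] Coprime (toℕ a) n

Seq : ℕ → ℕ → Set
Seq n k = Fin k → Fin n

sumOver : ∀ {k} → Subset k → (Fin k → ℕ) → ℕ
sumOver [] f = 0
sumOver (true ∷ I) f = f fzero + sumOver I (f ∘ fsuc)
sumOver (false ∷ I) f = sumOver I (f ∘ fsuc)

HasUZS : ∀ n {k} → Seq n k → Set
HasUZS n {k} x =
  Σ[ I ∈ Subset k ] Σ[ a ∈ (Fin k → U n) ]
    (Nonempty I × ∣ I ∣ ≡ n ×
     n ∣ sumOver I (λ i → toℕ (proj₁ (a i)) * toℕ (x i)))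

AllHaveUZS : ℕ → ℕ → Set
AllHaveUZS n k = (x : Seq n k) → HasUZS n x

IsEU : ℕ → ℕ → Set
IsEU n E = 1 ≤ E × AllHaveUZS n E × (∀ j → 1 ≤ j → AllHaveUZS n j → E ≤ j)

IsExtremalU : ∀ n {k} → Seq n k → Set
IsExtremalU n {k} x = IsEU n (suc k) × (HasUZS n x → ⊥)

UEquiv : ∀ n {k} → Seq n k → Seq n k → Set
UEquiv n {k} x y =
  Σ[ c ∈ U n ] Σ[ σ ∈ Permutation′ k ] Σ[ a ∈ (Fin k → U n) ]
    (∀ (i : Fin k) →
      (toℕ (proj₁ c) * toℕ (y (σ ⟨$⟩ʳ i))) ≡[mod n ] (toℕ (proj₁ (a i)) * toℕ (x i)))

count : ∀ {n k} → Seq n k → ℕ → ℕ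
count {k = zero} y v = 0
count {k = suc k} y v =
  (if toℕ (y fzero) ≡ᵇ v then 1 else 0) + count (y ∘ fsuc) v

IsNormalForm : (r : ℕ) → ∀ {k} → Seq (2 ^ r) k → Set
IsNormalForm r {k} y =
  (∀ i → i ≤ r ∸ 2 → count y (2 ^ i) ≡ 1) ×
  (Σ[ m ∈ ℕ ] (Σ[ h ∈ ℕ ] m ≡ 2 * h + 1) × 1 ≤ m × m ≤ 2 ^ r ∸ 1 ×
     count y (2 ^ (r ∸ 1)) ≡ m) ×
  (∀ j → toℕ (y j) ≡ 0 ⊎ (Σ[ i ∈ ℕ ] i ≤ r ∸ 1 × toℕ (y j) ≡ 2 ^ i))
  where open import Data.Sum using (_⊎_)

{-# OPTIONS --safe #-}
-- Multiplying every term by a suitable unit turns an extremal x into a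
-- sequence y of zeros and powers 2^j (j < r) that still has no U(n)-weighted zero-sum of
-- length n. Let c_w count the terms of y equal to 2^w and H_w those divisible by 2^w, so
-- that H_w = c_w + H_(w+1) and H_0 = k = n + r − 1; the lower bound E ≥ n + r comes from
-- 1, 2, …, 2^(r−1) followed by n − 1 zeros, whose weighted sums are 0 or 2^v times an odd
-- number. Zero-sum-freeness gives H_r < n (n multiples of n would do) and A + H_(w+1) < n
-- for every even A with 1 ≤ A ≤ c_w: A copies of 2^w together with multiples of 2^(w+1)
-- have a sum divisible by 2^(w+1), and reweighting a single copy of 2^w makes it vanish
-- modulo n. For the least w with c_w ≥ 2 (or w = r if there is none) the chain
-- k ≤ w + H_w ≤ (r − 1) + n = k is therefore tight, which forces c_u = 1 for u < w and,
-- when w < r, also w = r − 1 and H_w = n, so that c_(r−1) is odd.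

module Submission where

open import Defs
open import Data.Nat using (ℕ; _≤_; _^_)
open import Data.Product using (Σ-syntax; _×_)
open import Data.Nat
open import Data.Nat.Properties
open import Data.Nat.Divisibility
open import Data.Nat.DivMod
open import Data.Nat.Coprimality using (Coprime; coprime-divisor; coprime-Bézout)
open import Data.Nat.GCD using (module Bézout)
open import Data.Nat.Primality using (prime[2]; irreducible[2]; euclidsLemma)
open import Data.Bool using (true; false; if_then_else_)
open import Data.Fin using (Fin; toℕ; fromℕ<) renaming (zero to fzero; suc to fsuc; _≟_ to _≟ᶠ_)
open import Data.Fin.Properties using (toℕ<n; toℕ-fromℕ<) renaming (suc-injective to fsuc-injective)
open import Data.Fin.Subset using (Subset; ∣_∣; Nonempty; _∈_; _∉_; _∪_)
open import Data.Fin.Subset.Properties using (x∈p∪q⁺; ∣p∣≤n)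
import Data.Fin.Permutation as Perm
open import Data.Vec using ([]; _∷_; here; there)
open import Data.Product using (_,_; proj₁; proj₂)
open import Data.Sum using (_⊎_; inj₁; inj₂)
open import Function using (_∘_)
open import Relation.Nullary using (¬_; Dec; yes; no; does; contradiction)
open import Relation.Unary using (Pred; Decidable)
open import Level using (0ℓ)
open import Relation.Binary.PropositionalEquality
open import Algebra.Properties.CommutativeSemigroup +-commutativeSemigroup
  using (interchange; x∙yz≈y∙xz; xy∙z≈xz∙y; xy∙z≈zy∙x)
open import Algebra.Properties.CommutativeSemigroup *-commutativeSemigroup
  using () renaming (x∙yz≈y∙xz to x*[y*z]≡y*[x*z])
open import Data.Nat.Tactic.RingSolver using (solve-∀)

private
  variable
    k m n d : ℕ

2∣2^suc : ∀ e → 2 ∣ 2 ^ suc e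
2∣2^suc e = divides (2 ^ e) (*-comm 2 (2 ^ e))

2∤1 : 2 ∤ 1
2∤1 2∣1 with ∣1⇒≡1 2∣1
... | ()

odd-∣ : d ∣ m → 2 ∤ m → 2 ∤ d
odd-∣ d∣m 2∤m 2∣d = 2∤m (∣-trans 2∣d d∣m)

odd-* : 2 ∤ m → 2 ∤ n → 2 ∤ m * n
odd-* {m} {n} 2∤m 2∤n 2∣mn with euclidsLemma m n prime[2] 2∣mn
... | inj₁ 2∣m = 2∤m 2∣m
... | inj₂ 2∣n = 2∤n 2∣n

odd⇒≥1 : 2 ∤ m → 1 ≤ m
odd⇒≥1 {zero}  2∤0 = contradiction (2 ∣0) 2∤0
odd⇒≥1 {suc m} _   = s≤s z≤n

odd⇒2h+1 : 2 ∤ m → Σ[ h ∈ ℕ ] m ≡ 2 * h + 1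
odd⇒2h+1 {m} 2∤m = m / 2 , (begin
  m                 ≡⟨ m≡m%n+[m/n]*n m 2 ⟩
  m % 2 + m / 2 * 2 ≡⟨ cong (_+ m / 2 * 2) m%2≡1 ⟩
  1 + m / 2 * 2     ≡⟨ +-comm 1 (m / 2 * 2) ⟩
  m / 2 * 2 + 1     ≡⟨ cong (_+ 1) (*-comm (m / 2) 2) ⟩
  2 * (m / 2) + 1   ∎)
  where
  open ≡-Reasoning
  m%2≡1 : m % 2 ≡ 1
  m%2≡1 with m % 2 | m%n<n m 2 | m%n≡0⇒n∣m m 2
  ... | 0 | _ | 0⇒2∣m = contradiction (0⇒2∣m refl) 2∤m
  ... | 1 | _ | _ = refl
  ... | suc (suc _) | s≤s (s≤s () ) | _

odd-below-2⇒≡1 : 2 ∤ m → m < 2 → m ≡ 1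
odd-below-2⇒≡1 2∤m m<2 = ≤-antisym (≤-pred m<2) (odd⇒≥1 2∤m)

odd≤even⇒< : 2 ∤ m → 2 ∣ n → m ≤ n → m < n
odd≤even⇒< 2∤m 2∣n m≤n = ≤∧≢⇒< m≤n λ { refl → 2∤m 2∣n }

odd⇒coprime-2 : 2 ∤ m → Coprime m 2
odd⇒coprime-2 2∤m (d∣m , d∣2) with irreducible[2] d∣2
... | inj₁ d≡1 = d≡1
... | inj₂ refl = contradiction d∣m 2∤m

odd⇒coprime-2^ : ∀ e → 2 ∤ m → Coprime m (2 ^ e)
odd⇒coprime-2^ zero    2∤m (_ , d∣1) = ∣1⇒≡1 d∣1
odd⇒coprime-2^ (suc e) 2∤m (d∣m , d∣2^[1+e]) =
  odd⇒coprime-2^ e 2∤m (d∣m , coprime-divisor (odd⇒coprime-2 (odd-∣ d∣m 2∤m)) d∣2^[1+e])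

coprime-2^suc⇒odd : ∀ e → Coprime m (2 ^ suc e) → 2 ∤ m
coprime-2^suc⇒odd e coprime 2∣m with coprime (2∣m , 2∣2^suc e)
... | ()

2^∣2^⇒≤ : ∀ a b → 2 ^ a ∣ 2 ^ b → a ≤ b
2^∣2^⇒≤ a b 2^a∣2^b with a ≤? b
... | yes a≤b = a≤b
... | no  a≰b =
  contradiction (∣⇒≤ {{m^n≢0 2 b}} 2^a∣2^b) (<⇒≱ (^-monoʳ-< 2 (s≤s (s≤s z≤n)) (≰⇒> a≰b)))

≤⇒2^∣2^ : ∀ {a b} → a ≤ b → 2 ^ a ∣ 2 ^ b
≤⇒2^∣2^ {a} a≤b with m≤n⇒∃[o]m+o≡n a≤b
... | (o , refl) = divides (2 ^ o) (trans (^-distribˡ-+-* 2 a o) (*-comm (2 ^ a) (2 ^ o)))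

2^suc∤2^*odd : ∀ {a o} → 2 ∤ o → 2 ^ suc a ∤ 2 ^ a * o
2^suc∤2^*odd {a} {o} 2∤o 2^[1+a]∣ = 2∤o (*-cancelˡ-∣ (2 ^ a) {{m^n≢0 2 a}}
  (subst (_∣ 2 ^ a * o) (*-comm 2 (2 ^ a)) 2^[1+a]∣))

power-times-odd : ∀ e v → 0 < v → v < 2 ^ e →
  Σ[ j ∈ ℕ ] Σ[ o ∈ ℕ ] (j < e × 2 ∤ o × v ≡ 2 ^ j * o)
power-times-odd zero    v 0<v v<1 = contradiction (≤-trans v<1 0<v) (<-irrefl refl)
power-times-odd (suc e) v 0<v v<2^[1+e] with 2 ∣? v
... | no 2∤v = 0 , v , z<s , 2∤v , sym (+-identityʳ v)
... | yes (divides h refl) with power-times-odd e h 0<h (*-cancelʳ-< 2 h (2 ^ e) h*2<2^e*2)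
  where
  0<h : 0 < h
  0<h = n≢0⇒n>0 λ { refl → <-irrefl refl 0<v }
  h*2<2^e*2 : h * 2 < 2 ^ e * 2
  h*2<2^e*2 = subst (h * 2 <_) (*-comm 2 (2 ^ e)) v<2^[1+e]
... | (j , o , j<e , 2∤o , refl) = suc j , o , s≤s j<e , 2∤o , (begin
  2 ^ j * o * 2   ≡⟨ *-comm (2 ^ j * o) 2 ⟩
  2 * (2 ^ j * o) ≡⟨ *-assoc 2 (2 ^ j) o ⟨
  2 ^ suc j * o   ∎)
  where open ≡-Reasoning

module _ {n : ℕ} .{{_ : NonZero n}} where

  ∣n∣m⇒∣m%n : d ∣ n → d ∣ m → d ∣ m % n
  ∣n∣m⇒∣m%n {d} {m} d∣n d∣m = ∣m+n∣m⇒∣n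
    (subst (d ∣_) (trans (m≡m%n+[m/n]*n m n) (+-comm (m % n) (m / n * n))) d∣m)
    (∣n⇒∣m*n (m / n) d∣n)

  %≡⇒≡[mod] : ∀ {a b} → a % n ≡ b % n → a ≡[mod n ] b
  %≡⇒≡[mod] {a} {b} eq = b / n , a / n , (begin
    a + b / n * n                 ≡⟨ cong (_+ b / n * n) (m≡m%n+[m/n]*n a n) ⟩
    a % n + a / n * n + b / n * n ≡⟨ cong (λ r → r + a / n * n + b / n * n) eq ⟩
    b % n + a / n * n + b / n * n ≡⟨ xy∙z≈xz∙y (b % n) (a / n * n) (b / n * n) ⟩
    b % n + b / n * n + a / n * n ≡⟨ cong (_+ a / n * n) (m≡m%n+[m/n]*n b n) ⟨
    b + a / n * n                 ∎)
    where open ≡-Reasoning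

  *-congˡ-% : ∀ c {a b} → a % n ≡ b % n → (c * a) % n ≡ (c * b) % n
  *-congˡ-% c {a} {b} eq = begin
    (c * a) % n               ≡⟨ %-distribˡ-* c a n ⟩
    ((c % n) * (a % n)) % n   ≡⟨ cong (λ r → ((c % n) * r) % n) eq ⟩
    ((c % n) * (b % n)) % n   ≡⟨ %-distribˡ-* c b n ⟨
    (c * b) % n               ∎
    where open ≡-Reasoning

  [m%n*o]%n≡[m*o]%n : ∀ a b → ((a % n) * b) % n ≡ (a * b) % n
  [m%n*o]%n≡[m*o]%n a b = begin
    ((a % n) * b) % n           ≡⟨ %-distribˡ-* (a % n) b n ⟩
    ((a % n % n) * (b % n)) % n ≡⟨ cong (λ r → (r * (b % n)) % n) (m%n%n≡m%n a n) ⟩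
    ((a % n) * (b % n)) % n     ≡⟨ %-distribˡ-* a b n ⟨
    (a * b) % n                 ∎
    where open ≡-Reasoning

  sumOver-cong-% : ∀ (I : Subset k) {f g : Fin k → ℕ} →
    (∀ i → f i % n ≡ g i % n) → sumOver I f % n ≡ sumOver I g % n
  sumOver-cong-% []          eq = refl
  sumOver-cong-% (false ∷ I) eq = sumOver-cong-% I (eq ∘ fsuc)
  sumOver-cong-% (true ∷ I) {f} {g} eq = begin
    (f fzero + sumOver I (f ∘ fsuc)) % n
      ≡⟨ %-distribˡ-+ (f fzero) _ n ⟩
    (f fzero % n + sumOver I (f ∘ fsuc) % n) % n
      ≡⟨ cong₂ (λ a b → (a + b) % n) (eq fzero) (sumOver-cong-% I (eq ∘ fsuc)) ⟩
    (g fzero % n + sumOver I (g ∘ fsuc) % n) % n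
      ≡⟨ %-distribˡ-+ (g fzero) _ n ⟨
    (g fzero + sumOver I (g ∘ fsuc)) % n
      ∎
    where open ≡-Reasoning

  ∣-resp-% : ∀ {a b} → a % n ≡ b % n → n ∣ a → n ∣ b
  ∣-resp-% {a} {b} eq n∣a = m%n≡0⇒n∣m b n (trans (sym eq) (n∣m⇒m%n≡0 a n n∣a))

sumOver-cong : ∀ (I : Subset k) {f g : Fin k → ℕ} →
  (∀ i → i ∈ I → f i ≡ g i) → sumOver I f ≡ sumOver I g
sumOver-cong []          eq = refl
sumOver-cong (false ∷ I) eq = sumOver-cong I (λ i i∈I → eq (fsuc i) (there i∈I))
sumOver-cong (true ∷ I)  eq =
  cong₂ _+_ (eq fzero here) (sumOver-cong I (λ i i∈I → eq (fsuc i) (there i∈I)))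

sumOver-const : ∀ (I : Subset k) {f : Fin k → ℕ} {v} →
  (∀ i → i ∈ I → f i ≡ v) → sumOver I f ≡ ∣ I ∣ * v
sumOver-const []          eq = refl
sumOver-const (false ∷ I) eq = sumOver-const I (λ i i∈I → eq (fsuc i) (there i∈I))
sumOver-const (true ∷ I)  eq =
  cong₂ _+_ (eq fzero here) (sumOver-const I (λ i i∈I → eq (fsuc i) (there i∈I)))

sumOver-*ˡ : ∀ (I : Subset k) c (f : Fin k → ℕ) → sumOver I (λ i → c * f i) ≡ c * sumOver I f
sumOver-*ˡ []          c f = sym (*-zeroʳ c)
sumOver-*ˡ (false ∷ I) c f = sumOver-*ˡ I c (f ∘ fsuc)
sumOver-*ˡ (true ∷ I)  c f =
  trans (cong (c * f fzero +_) (sumOver-*ˡ I c (f ∘ fsuc))) (sym (*-distribˡ-+ c (f fzero) _))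

sumOver-double : ∀ (I : Subset k) (a g : Fin k → ℕ) →
  sumOver I (λ i → a i * (2 * g i)) ≡ 2 * sumOver I (λ i → a i * g i)
sumOver-double I a g = trans (sumOver-cong I (λ i _ → x*[y*z]≡y*[x*z] (a i) 2 (g i))) (sumOver-*ˡ I 2 _)

∣-sumOver : ∀ (I : Subset k) {f : Fin k → ℕ} → (∀ i → i ∈ I → d ∣ f i) → d ∣ sumOver I f
∣-sumOver []          d∣f = _ ∣0
∣-sumOver (false ∷ I) d∣f = ∣-sumOver I (λ i i∈I → d∣f (fsuc i) (there i∈I))
∣-sumOver (true ∷ I)  d∣f =
  ∣m∣n⇒∣m+n (d∣f fzero here) (∣-sumOver I (λ i i∈I → d∣f (fsuc i) (there i∈I)))

nonempty : ∀ (p : Subset k) → 1 ≤ ∣ p ∣ → Nonempty p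
nonempty (true ∷ p)  _ = fzero , here
nonempty (false ∷ p) 1≤∣p∣ with nonempty p 1≤∣p∣
... | (i , i∈p) = fsuc i , there i∈p

Disjoint : Subset k → Subset k → Set
Disjoint p q = ∀ {i} → i ∈ p → i ∉ q

Disjoint-tail : ∀ {a b} {p q : Subset k} → Disjoint (a ∷ p) (b ∷ q) → Disjoint p q
Disjoint-tail disj i∈p i∈q = disj (there i∈p) (there i∈q)

∣p∪q∣≡∣p∣+∣q∣ : ∀ (p q : Subset k) → Disjoint p q → ∣ p ∪ q ∣ ≡ ∣ p ∣ + ∣ q ∣
∣p∪q∣≡∣p∣+∣q∣ []          []          _    = refl
∣p∪q∣≡∣p∣+∣q∣ (true ∷ p)  (true ∷ q)  disj = contradiction here (disj here)
∣p∪q∣≡∣p∣+∣q∣ (true ∷ p)  (false ∷ q) disj = cong suc (∣p∪q∣≡∣p∣+∣q∣ p q (Disjoint-tail disj))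
∣p∪q∣≡∣p∣+∣q∣ (false ∷ p) (true ∷ q)  disj =
  trans (cong suc (∣p∪q∣≡∣p∣+∣q∣ p q (Disjoint-tail disj))) (sym (+-suc ∣ p ∣ ∣ q ∣))
∣p∪q∣≡∣p∣+∣q∣ (false ∷ p) (false ∷ q) disj = ∣p∪q∣≡∣p∣+∣q∣ p q (Disjoint-tail disj)

sumOver-∪ : ∀ (p q : Subset k) (f : Fin k → ℕ) → Disjoint p q →
  sumOver (p ∪ q) f ≡ sumOver p f + sumOver q f
sumOver-∪ []          []          f _    = refl
sumOver-∪ (true ∷ p)  (true ∷ q)  f disj = contradiction here (disj here)
sumOver-∪ (true ∷ p)  (false ∷ q) f disj =
  trans (cong (f fzero +_) (sumOver-∪ p q (f ∘ fsuc) (Disjoint-tail disj))) (sym (+-assoc (f fzero) _ _))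
sumOver-∪ (false ∷ p) (true ∷ q)  f disj =
  trans (cong (f fzero +_) (sumOver-∪ p q (f ∘ fsuc) (Disjoint-tail disj)))
        (x∙yz≈y∙xz (f fzero) (sumOver p (f ∘ fsuc)) (sumOver q (f ∘ fsuc)))
sumOver-∪ (false ∷ p) (false ∷ q) f disj = sumOver-∪ p q (f ∘ fsuc) (Disjoint-tail disj)

sumOver-update : ∀ (I : Subset k) {f g : Fin k → ℕ} {i₀} → i₀ ∈ I →
  (∀ i → i ≢ i₀ → g i ≡ f i) → sumOver I g + f i₀ ≡ sumOver I f + g i₀
sumOver-update (true ∷ I) {f} {g} here g≡f = begin
  g fzero + sumOver I (g ∘ fsuc) + f fzero ≡⟨ cong (λ s → g fzero + s + f fzero) rest ⟩
  g fzero + sumOver I (f ∘ fsuc) + f fzero ≡⟨ xy∙z≈zy∙x (g fzero) _ (f fzero) ⟩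
  f fzero + sumOver I (f ∘ fsuc) + g fzero ∎
  where
  open ≡-Reasoning
  rest : sumOver I (g ∘ fsuc) ≡ sumOver I (f ∘ fsuc)
  rest = sumOver-cong I (λ i _ → g≡f (fsuc i) λ ())
sumOver-update (false ∷ I) (there i₀∈I) g≡f =
  sumOver-update I i₀∈I (λ i i≢i₀ → g≡f (fsuc i) (i≢i₀ ∘ fsuc-injective))
sumOver-update (true ∷ I) {f} {g} {fsuc i₀} (there i₀∈I) g≡f = begin
  g fzero + sumOver I (g ∘ fsuc) + f (fsuc i₀)   ≡⟨ +-assoc (g fzero) _ _ ⟩
  g fzero + (sumOver I (g ∘ fsuc) + f (fsuc i₀)) ≡⟨ cong₂ _+_ (g≡f fzero λ ()) rest ⟩
  f fzero + (sumOver I (f ∘ fsuc) + g (fsuc i₀)) ≡⟨ +-assoc (f fzero) _ _ ⟨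
  f fzero + sumOver I (f ∘ fsuc) + g (fsuc i₀)   ∎
  where
  open ≡-Reasoning
  rest : sumOver I (g ∘ fsuc) + f (fsuc i₀) ≡ sumOver I (f ∘ fsuc) + g (fsuc i₀)
  rest = sumOver-update I i₀∈I (λ i i≢i₀ → g≡f (fsuc i) (i≢i₀ ∘ fsuc-injective))

indicator : ∀ {A : Set} → Dec A → ℕ
indicator A? = if does A? then 1 else 0

indicator-yes : ∀ {A : Set} (A? : Dec A) → A → indicator A? ≡ 1
indicator-yes (yes _) _ = refl
indicator-yes (no ¬a) a = contradiction a ¬a

indicator-no : ∀ {A : Set} (A? : Dec A) → ¬ A → indicator A? ≡ 0
indicator-no (yes a) ¬a = contradiction a ¬a
indicator-no (no _)  _  = refl

indicator-split : ∀ {A B C : Set} (A? : Dec A) (B? : Dec B) (C? : Dec C) →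
  (A → B ⊎ C) → (B → A) → (C → A) → (B → ¬ C) → indicator A? ≡ indicator B? + indicator C?
indicator-split (yes a) (yes b) (yes c) _   _   _   b⇒¬c = contradiction c (b⇒¬c b)
indicator-split (yes a) (yes b) (no _)  _   _   _   _    = refl
indicator-split (yes a) (no _)  (yes c) _   _   _   _    = refl
indicator-split (yes a) (no ¬b) (no ¬c) a⇒  _   _   _    with a⇒ a
... | inj₁ b = contradiction b ¬b
... | inj₂ c = contradiction c ¬c
indicator-split (no ¬a) (yes b) _       _   b⇒a _   _    = contradiction (b⇒a b) ¬a
indicator-split (no ¬a) (no _)  (yes c) _   _   c⇒a _    = contradiction (c⇒a c) ¬a
indicator-split (no ¬a) (no _)  (no _)  _   _   _   _    = refl

countWhere : ∀ {k} {P : Pred (Fin k) 0ℓ} → Decidable P → ℕ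
countWhere {zero}  P? = 0
countWhere {suc k} P? = indicator (P? fzero) + countWhere (P? ∘ fsuc)

count≡countWhere : ∀ {n k} (y : Seq n k) v → count y v ≡ countWhere (λ i → toℕ (y i) ≟ v)
count≡countWhere {k = zero}  y v = refl
count≡countWhere {k = suc k} y v = cong (indicator (toℕ (y fzero) ≟ v) +_) (count≡countWhere (y ∘ fsuc) v)

countWhere-split : ∀ {k} {P Q R : Pred (Fin k) 0ℓ} (P? : Decidable P) (Q? : Decidable Q) (R? : Decidable R) →
  (∀ i → indicator (P? i) ≡ indicator (Q? i) + indicator (R? i)) →
  countWhere P? ≡ countWhere Q? + countWhere R?
countWhere-split {zero}  P? Q? R? split = refl
countWhere-split {suc k} P? Q? R? split = begin
  indicator (P? fzero) + countWhere (P? ∘ fsuc)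
    ≡⟨ cong₂ _+_ (split fzero) (countWhere-split (P? ∘ fsuc) (Q? ∘ fsuc) (R? ∘ fsuc) (split ∘ fsuc)) ⟩
  indicator (Q? fzero) + indicator (R? fzero) + (countWhere (Q? ∘ fsuc) + countWhere (R? ∘ fsuc))
    ≡⟨ interchange (indicator (Q? fzero)) _ _ _ ⟩
  indicator (Q? fzero) + countWhere (Q? ∘ fsuc) + (indicator (R? fzero) + countWhere (R? ∘ fsuc)) ∎
  where open ≡-Reasoning

countWhere-all : ∀ {k} {P : Pred (Fin k) 0ℓ} (P? : Decidable P) → (∀ i → P i) → countWhere P? ≡ k
countWhere-all {zero}  P? all = refl
countWhere-all {suc k} P? all with P? fzero
... | yes _  = cong suc (countWhere-all (P? ∘ fsuc) (all ∘ fsuc))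
... | no ¬p  = contradiction (all fzero) ¬p

firstWhere : ∀ {k} {P : Pred (Fin k) 0ℓ} → Decidable P → ℕ → Subset k
firstWhere {zero}  P? n = []
firstWhere {suc k} P? n with P? fzero | n
... | yes _ | suc n′ = true  ∷ firstWhere (P? ∘ fsuc) n′
... | yes _ | zero   = false ∷ firstWhere (P? ∘ fsuc) zero
... | no _  | n′     = false ∷ firstWhere (P? ∘ fsuc) n′

∣firstWhere∣ : ∀ {k} {P : Pred (Fin k) 0ℓ} (P? : Decidable P) {n} →
  n ≤ countWhere P? → ∣ firstWhere P? n ∣ ≡ n
∣firstWhere∣ {zero}  P? z≤n = refl
∣firstWhere∣ {suc k} P? {n} n≤c with P? fzero | n
... | yes _ | suc n′ = cong suc (∣firstWhere∣ (P? ∘ fsuc) (≤-pred n≤c))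
... | yes _ | zero   = ∣firstWhere∣ (P? ∘ fsuc) z≤n
... | no _  | n′     = ∣firstWhere∣ (P? ∘ fsuc) n≤c

firstWhere⊆ : ∀ {k} {P : Pred (Fin k) 0ℓ} (P? : Decidable P) {n i} → i ∈ firstWhere P? n → P i
firstWhere⊆ {suc k} P? {n} i∈ with P? fzero | n | i∈
... | yes p | suc n′ | here        = p
... | yes _ | suc n′ | there i∈′   = firstWhere⊆ (P? ∘ fsuc) i∈′
... | yes _ | zero   | there i∈′   = firstWhere⊆ (P? ∘ fsuc) i∈′
... | no _  | n′     | there i∈′   = firstWhere⊆ (P? ∘ fsuc) i∈′

-- The lower bound for E

HasUZS-fromTail : ∀ {n k} (x : Seq n (suc k)) → HasUZS n (x ∘ fsuc) → HasUZS n x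
HasUZS-fromTail {n} {k} x (I , a , (p , p∈I) , ∣I∣≡n , n∣Σ) =
  false ∷ I , b , (fsuc p , there p∈I) , ∣I∣≡n , n∣Σ
  where
  b : Fin (suc k) → U n
  b fzero    = a p
  b (fsuc i) = a i

AllHaveUZS-mono : ∀ {n j} d → AllHaveUZS n j → AllHaveUZS n (d + j)
AllHaveUZS-mono zero    all = all
AllHaveUZS-mono (suc d) all x = HasUZS-fromTail x (AllHaveUZS-mono d all (x ∘ fsuc))

pow2Below : ℕ → ℕ → ℕ
pow2Below zero    j       = 0
pow2Below (suc R) zero    = 1
pow2Below (suc R) (suc j) = 2 * pow2Below R j

pow2Below<2^ : ∀ R j → pow2Below R j < 2 ^ R
pow2Below<2^ zero    j       = z<s
pow2Below<2^ (suc R) zero    = *-monoʳ-≤ 2 {1} (m^n>0 2 R)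
pow2Below<2^ (suc R) (suc j) = *-monoʳ-< 2 (pow2Below<2^ R j)

pow2Below-weighted-sum : ∀ R {k} (I : Subset k) (a : Fin k → ℕ) → (∀ i → 2 ∤ a i) → R ≤ k →
  let S = sumOver I (λ i → a i * pow2Below R (toℕ i)) in
  ∣ I ∣ + R ≤ k ⊎ (Σ[ v ∈ ℕ ] Σ[ o ∈ ℕ ] (v < R × 2 ∤ o × S ≡ 2 ^ v * o))
pow2Below-weighted-sum zero I a odd _ = inj₁ (≤-trans (≤-reflexive (+-identityʳ ∣ I ∣)) (∣p∣≤n I))
pow2Below-weighted-sum (suc R) (true ∷ I) a odd _ = inj₂ (0 , _ , z<s , sum-odd , sym (+-identityʳ _))
  where
  2∣rest : 2 ∣ sumOver I (λ i → a (fsuc i) * (2 * pow2Below R (toℕ i)))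
  2∣rest = ∣-sumOver I (λ i _ → ∣n⇒∣m*n (a (fsuc i)) (∣m⇒∣m*n (pow2Below R (toℕ i)) ∣-refl))
  sum-odd : 2 ∤ a fzero * 1 + sumOver I (λ i → a (fsuc i) * (2 * pow2Below R (toℕ i)))
  sum-odd 2∣sum = odd fzero (subst (2 ∣_) (*-identityʳ (a fzero))
    (∣m+n∣m⇒∣n (subst (2 ∣_) (+-comm (a fzero * 1) _) 2∣sum) 2∣rest))
pow2Below-weighted-sum (suc R) {suc k} (false ∷ I) a odd R<k
  with pow2Below-weighted-sum R I (a ∘ fsuc) (odd ∘ fsuc) (≤-pred R<k)
... | inj₁ ∣I∣+R≤k = inj₁ (subst (_≤ suc k) (sym (+-suc ∣ I ∣ R)) (s≤s ∣I∣+R≤k))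
... | inj₂ (v , o , v<R , 2∤o , S≡) =
  inj₂ (suc v , o , s<s v<R , 2∤o ,
        trans (sumOver-double I (a ∘ fsuc) (pow2Below R ∘ toℕ))
              (trans (cong (2 *_) S≡) (sym (*-assoc 2 (2 ^ v) o))))

-- Counting terms by their 2-adic valuation

ZeroOrPowerOfTwo : ℕ → ℕ → Set
ZeroOrPowerOfTwo s v = v ≡ 0 ⊎ Σ[ j ∈ ℕ ] (j ≤ s × v ≡ 2 ^ j)

divisibility-split : ∀ s w v → ZeroOrPowerOfTwo s v →
  indicator (2 ^ w ∣? v) ≡ indicator (v ≟ 2 ^ w) + indicator (2 ^ suc w ∣? v)
divisibility-split s w v v-form = indicator-split (2 ^ w ∣? v) (v ≟ 2 ^ w) (2 ^ suc w ∣? v)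
  (exact-or-higher v-form) (λ { refl → ∣-refl }) (∣-trans (≤⇒2^∣2^ (n≤1+n w)))
  (λ { refl → 1+n≰n ∘ 2^∣2^⇒≤ (suc w) w })
  where
  exact-or-higher : ZeroOrPowerOfTwo s v → 2 ^ w ∣ v → v ≡ 2 ^ w ⊎ 2 ^ suc w ∣ v
  exact-or-higher (inj₁ refl)            _      = inj₂ ((2 ^ suc w) ∣0)
  exact-or-higher (inj₂ (j , _ , refl)) 2^w∣2^j with m≤n⇒m<n∨m≡n (2^∣2^⇒≤ w j 2^w∣2^j)
  ... | inj₁ w<j  = inj₂ (≤⇒2^∣2^ w<j)
  ... | inj₂ refl = inj₁ refl

divisibleCount : ∀ {n k} → Seq n k → ℕ → ℕ
divisibleCount y w = countWhere (λ i → 2 ^ w ∣? toℕ (y i))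

divisibleCount-zero : ∀ {n k} (y : Seq n k) → divisibleCount y 0 ≡ k
divisibleCount-zero y = countWhere-all _ (λ i → 1∣ toℕ (y i))

divisibleCount-step : ∀ s {n k} (y : Seq n k) → (∀ i → ZeroOrPowerOfTwo s (toℕ (y i))) →
  ∀ w → divisibleCount y w ≡ count y (2 ^ w) + divisibleCount y (suc w)
divisibleCount-step s y y-form w =
  trans (countWhere-split _ _ _ (λ i → divisibility-split s w (toℕ (y i)) (y-form i)))
        (cong (_+ divisibleCount y (suc w)) (sym (count≡countWhere y (2 ^ w))))

sumBelow : ℕ → (ℕ → ℕ) → ℕ
sumBelow zero    c = 0
sumBelow (suc n) c = sumBelow n c + c n

AtMostOneBelow : ℕ → (ℕ → ℕ) → Set
AtMostOneBelow n c = ∀ u → u < n → c u ≤ 1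

telescope : ∀ (c H : ℕ → ℕ) → (∀ w → H w ≡ c w + H (suc w)) → ∀ n → H 0 ≡ sumBelow n c + H n
telescope c H step zero    = refl
telescope c H step (suc n) = begin
  H 0                             ≡⟨ telescope c H step n ⟩
  sumBelow n c + H n              ≡⟨ cong (sumBelow n c +_) (step n) ⟩
  sumBelow n c + (c n + H (suc n)) ≡⟨ +-assoc (sumBelow n c) (c n) (H (suc n)) ⟨
  sumBelow n c + c n + H (suc n)  ∎
  where open ≡-Reasoning

sumBelow-≤ : ∀ n {c} → AtMostOneBelow n c → sumBelow n c ≤ n
sumBelow-≤ zero    _    = z≤n
sumBelow-≤ (suc n) ≤1 =
  ≤-trans (+-mono-≤ (sumBelow-≤ n (λ u u<n → ≤1 u (m<n⇒m<1+n u<n))) (≤1 n ≤-refl))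
          (≤-reflexive (+-comm n 1))

sumBelow-≥⇒ones : ∀ n {c} → AtMostOneBelow n c → n ≤ sumBelow n c → ∀ u → u < n → c u ≡ 1
sumBelow-≥⇒ones (suc n) {c} ≤1 suc[n]≤S = ones
  where
  ≤1′ : AtMostOneBelow n c
  ≤1′ u u<n = ≤1 u (m<n⇒m<1+n u<n)
  n+1≤S : n + 1 ≤ sumBelow n c + c n
  n+1≤S = ≤-trans (≤-reflexive (+-comm n 1)) suc[n]≤S
  n≤S : n ≤ sumBelow n c
  n≤S = +-cancelʳ-≤ 1 n (sumBelow n c) (≤-trans n+1≤S (+-monoʳ-≤ (sumBelow n c) (≤1 n ≤-refl)))
  1≤c : 1 ≤ c n
  1≤c = +-cancelˡ-≤ n 1 (c n) (≤-trans n+1≤S (+-monoˡ-≤ (c n) (sumBelow-≤ n ≤1′)))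
  ones : ∀ u → u < suc n → c u ≡ 1
  ones u u<1+n with m<1+n⇒m<n∨m≡n u<1+n
  ... | inj₁ u<n  = sumBelow-≥⇒ones n ≤1′ n≤S u u<n
  ... | inj₂ refl = ≤-antisym (≤1 n ≤-refl) 1≤c

first-above-one : ∀ (c : ℕ → ℕ) n →
  AtMostOneBelow n c ⊎ Σ[ w ∈ ℕ ] (w < n × 2 ≤ c w × AtMostOneBelow w c)
first-above-one c zero = inj₁ λ u ()
first-above-one c (suc n) with first-above-one c n
... | inj₂ (w , w<n , 2≤c , ≤1) = inj₂ (w , m<n⇒m<1+n w<n , 2≤c , ≤1)
... | inj₁ ≤1 with c n ≤? 1
...   | no  c≰1 = inj₂ (n , ≤-refl , ≰⇒> c≰1 , ≤1)
...   | yes c≤1 = inj₁ extended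
  where
  extended : AtMostOneBelow (suc n) c
  extended u u<1+n with m<1+n⇒m<n∨m≡n u<1+n
  ... | inj₁ u<n  = ≤1 u u<n
  ... | inj₂ refl = c≤1

-- In the application c w is the number of terms equal to 2^w and H w the number of terms
-- divisible by 2^w.
module LevelCounts {N s k : ℕ} (c H : ℕ → ℕ) (2∣N : 2 ∣ N)
  (step : ∀ w → H w ≡ c w + H (suc w)) (H0≡k : H 0 ≡ k) (N+s≤k : N + s ≤ k)
  (multiples< : H (suc s) < N)
  (pairs< : ∀ w A → 2 ∣ A → 1 ≤ A → A ≤ c w → A + H (suc w) < N) where

  tight-below : ∀ w → AtMostOneBelow w c → w + H w ≤ N + s →
    (∀ u → u < w → c u ≡ 1) × w + H w ≡ N + s
  tight-below w ≤1 w+H≤N+s =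
    sumBelow-≥⇒ones w ≤1 (+-cancelʳ-≤ (H w) w _ w+H≤S+H) , ≤-antisym w+H≤N+s N+s≤w+H
    where
    k≡S+H : k ≡ sumBelow w c + H w
    k≡S+H = trans (sym H0≡k) (telescope c H step w)
    w+H≤S+H : w + H w ≤ sumBelow w c + H w
    w+H≤S+H = ≤-trans w+H≤N+s (≤-trans N+s≤k (≤-reflexive k≡S+H))
    N+s≤w+H : N + s ≤ w + H w
    N+s≤w+H = ≤-trans N+s≤k (subst (_≤ w + H w) (sym k≡S+H) (+-monoˡ-≤ (H w) (sumBelow-≤ w ≤1)))

  Profile : Set
  Profile = (∀ u → u < s → c u ≡ 1) × 2 ∤ c s × c s < N

  no-repeated-level : AtMostOneBelow (suc s) c → Profile
  no-repeated-level ≤1 = (λ u u<s → ones u (m<n⇒m<1+n u<s)) , subst (2 ∤_) (sym c≡1) 2∤1 ,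
                         subst (_< N) (sym c≡1) (odd≤even⇒< 2∤1 2∣N (≤-trans (s≤s z≤n) multiples<))
    where
    bound : suc s + H (suc s) ≤ N + s
    bound = ≤-trans (≤-reflexive (sym (+-suc s (H (suc s)))))
                    (≤-trans (+-monoʳ-≤ s multiples<) (≤-reflexive (+-comm s N)))
    ones : ∀ u → u < suc s → c u ≡ 1
    ones = proj₁ (tight-below (suc s) ≤1 bound)
    c≡1 : c s ≡ 1
    c≡1 = ones s ≤-refl

  repeated-level : ∀ w → w < suc s → 2 ≤ c w → AtMostOneBelow w c → Profile
  repeated-level w w<1+s 2≤c ≤1 =
    (λ u u<s → proj₁ tight u (subst (u <_) (sym w≡s) u<s)) , subst (2 ∤_) (cong c w≡s) c-odd ,
    subst (_< N) (cong c w≡s) (odd≤even⇒< c-odd 2∣N c≤N)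
    where
    w≤s : w ≤ s
    w≤s = ≤-pred w<1+s
    A = c w / 2 * 2
    1≤A : 1 ≤ A
    1≤A = ≤-trans (m≥n⇒m/n>0 2≤c) (m≤m*n (c w / 2) 2)
    H≡ : H w ≡ c w % 2 + (A + H (suc w))
    H≡ = begin
      H w                        ≡⟨ step w ⟩
      c w + H (suc w)            ≡⟨ cong (_+ H (suc w)) (m≡m%n+[m/n]*n (c w) 2) ⟩
      c w % 2 + A + H (suc w)    ≡⟨ +-assoc (c w % 2) A (H (suc w)) ⟩
      c w % 2 + (A + H (suc w))  ∎
      where open ≡-Reasoning
    A+H<N : A + H (suc w) < N
    A+H<N = pairs< w A (divides (c w / 2) refl) 1≤A (m/n*n≤m (c w) 2)
    H≤N : H w ≤ N
    H≤N = ≤-trans (≤-reflexive H≡) (≤-trans (+-monoˡ-≤ _ (≤-pred (m%n<n (c w) 2))) A+H<N)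
    tight : (∀ u → u < w → c u ≡ 1) × w + H w ≡ N + s
    tight = tight-below w ≤1 (≤-trans (+-mono-≤ w≤s H≤N) (≤-reflexive (+-comm s N)))
    N+s≤w+N : N + s ≤ w + N
    N+s≤w+N = ≤-trans (≤-reflexive (sym (proj₂ tight))) (+-monoʳ-≤ w H≤N)
    w≡s : w ≡ s
    w≡s = ≤-antisym w≤s (+-cancelʳ-≤ N s w (subst (_≤ w + N) (+-comm N s) N+s≤w+N))
    N≤H : N ≤ H w
    N≤H = +-cancelˡ-≤ s N (H w) (≤-trans (≤-reflexive (+-comm s N))
            (≤-trans (≤-reflexive (sym (proj₂ tight))) (+-monoˡ-≤ (H w) w≤s)))
    c-odd : 2 ∤ c w
    c-odd 2∣c = <⇒≱ (subst (_< N) (sym H≡A+H) A+H<N) N≤H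
      where
      H≡A+H : H w ≡ A + H (suc w)
      H≡A+H = trans H≡ (cong (_+ (A + H (suc w))) (n∣m⇒m%n≡0 (c w) 2 2∣c))
    c≤N : c w ≤ N
    c≤N = ≤-trans (m≤m+n (c w) (H (suc w))) (≤-trans (≤-reflexive (sym (step w))) H≤N)

  profile : Profile
  profile with first-above-one c (suc s)
  ... | inj₁ ≤1                        = no-repeated-level ≤1
  ... | inj₂ (w , w<1+s , 2≤c , ≤1) = repeated-level w w<1+s 2≤c ≤1

-- The range i ≤ s ∸ 1 is {0}, not empty, when s = 0 (that is r = 1); there c 0 is odd and
-- below 2.
ones-up-to-pred : ∀ s (c : ℕ → ℕ) → (∀ u → u < s → c u ≡ 1) → 2 ∤ c s → c s < 2 ^ suc s →
  ∀ i → i ≤ s ∸ 1 → c i ≡ 1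
ones-up-to-pred zero    c _    c-odd c<2 zero z≤n = odd-below-2⇒≡1 c-odd c<2
ones-up-to-pred (suc s) c ones _     _   i    i≤s = ones i (s≤s i≤s)

-- Arithmetic modulo N = 2^(s+1)

-- s stands for r − 1 of the statement.
module PowerOfTwoModulus (s : ℕ) where

  N : ℕ
  N = 2 ^ suc s

  instance
    N≢0 : NonZero N
    N≢0 = m^n≢0 2 (suc s)

  1<N : 1 < N
  1<N = *-monoʳ-≤ 2 {1} (m^n>0 2 s)

  1%N≡1 : 1 % N ≡ 1
  1%N≡1 = m<n⇒m%n≡m 1<N

  odd-% : 2 ∤ m → 2 ∤ m % N
  odd-% 2∤m 2∣m%N = 2∤m (∣n∣m%n⇒∣m (2∣2^suc s) 2∣m%N)

  unit : ∀ m → 2 ∤ m → U N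
  unit m 2∤m = fromℕ< (m%n<n m N) ,
    odd⇒coprime-2^ (suc s) (subst (2 ∤_) (sym (toℕ-fromℕ< (m%n<n m N))) (odd-% 2∤m))

  toℕ-unit : ∀ m (2∤m : 2 ∤ m) → toℕ (proj₁ (unit m 2∤m)) ≡ m % N
  toℕ-unit m _ = toℕ-fromℕ< (m%n<n m N)

  unit-odd : (u : U N) → 2 ∤ toℕ (proj₁ u)
  unit-odd u = coprime-2^suc⇒odd s (proj₂ u)

  one : U N
  one = unit 1 2∤1

  toℕ-one : toℕ (proj₁ one) ≡ 1
  toℕ-one = trans (toℕ-unit 1 2∤1) 1%N≡1

  odd-inverse : 2 ∤ m → Σ[ w ∈ ℕ ] (w * m) % N ≡ 1
  odd-inverse {m} 2∤m with coprime-Bézout (odd⇒coprime-2^ (suc s) 2∤m)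
  ... | Bézout.+- x y eq = x , (begin
    (x * m) % N     ≡⟨ cong (_% N) eq ⟨
    (1 + y * N) % N ≡⟨ [m+kn]%n≡m%n 1 y N ⟩
    1 % N           ≡⟨ 1%N≡1 ⟩
    1               ∎)
    where open ≡-Reasoning
  ... | Bézout.-+ x y eq = pred N * x , (begin
    (pred N * x * m) % N               ≡⟨ [m+kn]%n≡m%n (pred N * x * m) y N ⟨
    (pred N * x * m + y * N) % N       ≡⟨ cong (λ t → (pred N * x * m + t) % N) eq ⟨
    (pred N * x * m + (1 + x * m)) % N ≡⟨ cong (_% N) (collect (pred N) x m) ⟩
    (1 + x * m * suc (pred N)) % N     ≡⟨ cong (λ t → (1 + x * m * t) % N) (suc-pred N) ⟩
    (1 + x * m * N) % N                ≡⟨ [m+kn]%n≡m%n 1 (x * m) N ⟩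
    1 % N                              ≡⟨ 1%N≡1 ⟩
    1                                  ∎)
    where
    open ≡-Reasoning
    collect : ∀ p x m → p * x * m + (1 + x * m) ≡ 1 + x * m * suc p
    collect = solve-∀

  unit-inverse : 2 ∤ m → Σ[ u ∈ U N ] (toℕ (proj₁ u) * m) % N ≡ 1
  unit-inverse {m} 2∤m with odd-inverse 2∤m
  ... | (w , wm≡1) = unit w 2∤w , (begin
    (toℕ (proj₁ (unit w 2∤w)) * m) % N ≡⟨ cong (λ t → (t * m) % N) (toℕ-unit w 2∤w) ⟩
    ((w % N) * m) % N                  ≡⟨ [m%n*o]%n≡[m*o]%n w m ⟩
    (w * m) % N                        ≡⟨ wm≡1 ⟩
    1                                  ∎)
    where
    open ≡-Reasoning
    2∤w : 2 ∤ w
    2∤w 2∣w = contradiction (subst (2 ∣_) wm≡1 (∣n∣m⇒∣m%n (2∣2^suc s) (∣m⇒∣m*n m 2∣w))) 2∤1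

  normalise : (v : Fin N) →
    Σ[ u ∈ U N ] Σ[ y ∈ Fin N ] ((toℕ (proj₁ u) * toℕ v) % N ≡ toℕ y % N × ZeroOrPowerOfTwo s (toℕ y))
  normalise v with toℕ v in v≡
  ... | zero = one , fromℕ< 0<N ,
    cong (_% N) (trans (*-zeroʳ (toℕ (proj₁ one))) (sym (toℕ-fromℕ< 0<N))) , inj₁ (toℕ-fromℕ< 0<N)
    where
    0<N : 0 < N
    0<N = m^n>0 2 (suc s)
  ... | suc v′ with power-times-odd (suc s) (suc v′) z<s (subst (_< N) v≡ (toℕ<n v))
  ... | (j , o , j<1+s , 2∤o , 1+v′≡) with unit-inverse 2∤o
  ... | (u , uo≡1) = u , fromℕ< 2^j<N , (begin
    (α * suc v′) % N       ≡⟨ cong (λ t → (α * t) % N) 1+v′≡ ⟩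
    (α * (2 ^ j * o)) % N  ≡⟨ cong (_% N) (x*[y*z]≡y*[x*z] α (2 ^ j) o) ⟩
    (2 ^ j * (α * o)) % N  ≡⟨ *-congˡ-% (2 ^ j) (trans uo≡1 (sym 1%N≡1)) ⟩
    (2 ^ j * 1) % N        ≡⟨ cong (_% N) (trans (*-identityʳ (2 ^ j)) (sym (toℕ-fromℕ< 2^j<N))) ⟩
    toℕ (fromℕ< 2^j<N) % N ∎) , inj₂ (j , ≤-pred j<1+s , toℕ-fromℕ< 2^j<N)
    where
    open ≡-Reasoning
    α = toℕ (proj₁ u)
    2^j<N : 2 ^ j < N
    2^j<N = ^-monoʳ-< 2 (s≤s (s≤s z≤n)) j<1+s

  normaliseSeq : ∀ {k} (x : Seq N k) → Σ[ a ∈ (Fin k → U N) ] Σ[ y ∈ Seq N k ]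
    ((∀ i → (toℕ (proj₁ (a i)) * toℕ (x i)) % N ≡ toℕ (y i) % N) × (∀ i → ZeroOrPowerOfTwo s (toℕ (y i))))
  normaliseSeq x = (λ i → proj₁ (nx i)) , (λ i → proj₁ (proj₂ (nx i))) ,
                   (λ i → proj₁ (proj₂ (proj₂ (nx i)))) , (λ i → proj₂ (proj₂ (proj₂ (nx i))))
    where nx = normalise ∘ x

  UEquiv-by-units : ∀ {k} (x y : Seq N k) (a : Fin k → U N) →
    (∀ i → (toℕ (proj₁ (a i)) * toℕ (x i)) % N ≡ toℕ (y i) % N) → UEquiv N x y
  UEquiv-by-units x y a ax≡y = one , Perm.id , a , λ i → %≡⇒≡[mod] (begin
    (toℕ (proj₁ one) * toℕ (y i)) % N ≡⟨ cong (λ t → (t * toℕ (y i)) % N) toℕ-one ⟩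
    (1 * toℕ (y i)) % N               ≡⟨ cong (_% N) (*-identityˡ (toℕ (y i))) ⟩
    toℕ (y i) % N                     ≡⟨ ax≡y i ⟨
    (toℕ (proj₁ (a i)) * toℕ (x i)) % N ∎)
    where open ≡-Reasoning

  transfer : ∀ {k} (x y : Seq N k) (a : Fin k → U N) →
    (∀ i → (toℕ (proj₁ (a i)) * toℕ (x i)) % N ≡ toℕ (y i) % N) →
    HasUZS N y → HasUZS N x
  transfer {k} x y a ax≡y (I , b , nonempty-I , ∣I∣≡N , N∣Σby) =
    I , b′ , nonempty-I , ∣I∣≡N , ∣-resp-% (sym (sumOver-cong-% I b′x≡by)) N∣Σby
    where
    α β : Fin k → ℕ
    α i = toℕ (proj₁ (a i))
    β i = toℕ (proj₁ (b i))
    βα-odd : ∀ i → 2 ∤ β i * α i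
    βα-odd i = odd-* (unit-odd (b i)) (unit-odd (a i))
    b′ : Fin k → U N
    b′ i = unit (β i * α i) (βα-odd i)
    b′x≡by : ∀ i → (toℕ (proj₁ (b′ i)) * toℕ (x i)) % N ≡ (β i * toℕ (y i)) % N
    b′x≡by i = begin
      (toℕ (proj₁ (b′ i)) * toℕ (x i)) % N
        ≡⟨ cong (λ t → (t * toℕ (x i)) % N) (toℕ-unit (β i * α i) (βα-odd i)) ⟩
      ((β i * α i) % N * toℕ (x i)) % N    ≡⟨ [m%n*o]%n≡[m*o]%n (β i * α i) (toℕ (x i)) ⟩
      (β i * α i * toℕ (x i)) % N          ≡⟨ cong (_% N) (*-assoc (β i) (α i) (toℕ (x i))) ⟩
      (β i * (α i * toℕ (x i))) % N        ≡⟨ *-congˡ-% (β i) (ax≡y i) ⟩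
      (β i * toℕ (y i)) % N                ∎
      where open ≡-Reasoning

  -- For m = N − 1 this is the zero-sum-free sequence behind the lower bound for E.
  powerSequence : ∀ m → Seq N (suc s + m)
  powerSequence m i = fromℕ< (pow2Below<2^ (suc s) (toℕ i))

  powerSequence-zeroSumFree : ∀ m → m < N → ¬ HasUZS N (powerSequence m)
  powerSequence-zeroSumFree m m<N (I , a , _ , ∣I∣≡N , N∣Σ)
    with pow2Below-weighted-sum (suc s) I (toℕ ∘ proj₁ ∘ a) (unit-odd ∘ a) (m≤m+n (suc s) m)
  ... | inj₁ ∣I∣+1+s≤1+s+m =
    <⇒≱ m<N (+-cancelˡ-≤ (suc s) N m (subst (_≤ suc s + m) ∣I∣+1+s≡1+s+N ∣I∣+1+s≤1+s+m))
    where
    ∣I∣+1+s≡1+s+N : ∣ I ∣ + suc s ≡ suc s + N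
    ∣I∣+1+s≡1+s+N = trans (cong (_+ suc s) ∣I∣≡N) (+-comm N (suc s))
  ... | inj₂ (v , o , v<1+s , 2∤o , Σ≡) =
    2^suc∤2^*odd {v} 2∤o (∣-trans (≤⇒2^∣2^ v<1+s) (subst (N ∣_) (trans Σ≡′ Σ≡) N∣Σ))
    where
    Σ≡′ : sumOver I (λ i → toℕ (proj₁ (a i)) * toℕ (powerSequence m i))
        ≡ sumOver I (λ i → toℕ (proj₁ (a i)) * pow2Below (suc s) (toℕ i))
    Σ≡′ = sumOver-cong I (λ i _ → cong (toℕ (proj₁ (a i)) *_) (toℕ-fromℕ< _))

  E-lower-bound : ∀ k → AllHaveUZS N (suc k) → N + s ≤ k
  E-lower-bound k all with N + s ≤? k
  ... | yes N+s≤k = N+s≤k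
  ... | no  N+s≰k with m≤n⇒∃[o]m+o≡n (≰⇒> N+s≰k)
  ... | (d , 1+k+d≡N+s) = contradiction
    (subst (AllHaveUZS N) lengths (AllHaveUZS-mono d all) (powerSequence (pred N)))
    (powerSequence-zeroSumFree (pred N) pred[N]<N)
    where
    pred[N]<N : pred N < N
    pred[N]<N = subst (pred N <_) (suc-pred N) ≤-refl
    lengths : d + suc k ≡ suc s + pred N
    lengths = begin
      d + suc k       ≡⟨ +-comm d (suc k) ⟩
      suc k + d       ≡⟨ 1+k+d≡N+s ⟩
      N + s           ≡⟨ +-comm N s ⟩
      s + N           ≡⟨ cong (s +_) (suc-pred N) ⟨
      s + suc (pred N) ≡⟨ +-suc s (pred N) ⟩
      suc s + pred N  ∎
      where open ≡-Reasoning

  zeroSum : ∀ {k} (y : Seq N k) (I : Subset k) (a : Fin k → U N) → ∣ I ∣ ≡ N →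
    N ∣ sumOver I (λ i → toℕ (proj₁ (a i)) * toℕ (y i)) → HasUZS N y
  zeroSum y I a ∣I∣≡N N∣Σ = I , a , nonempty I (subst (1 ≤_) (sym ∣I∣≡N) (<⇒≤ 1<N)) , ∣I∣≡N , N∣Σ

  zeroSum-multiples : ∀ {k} (y : Seq N k) → N ≤ divisibleCount y (suc s) → HasUZS N y
  zeroSum-multiples y N≤c = zeroSum y I (λ _ → one) (∣firstWhere∣ N∣y? N≤c)
    (∣-sumOver I (λ i i∈I → ∣n⇒∣m*n (toℕ (proj₁ one)) (firstWhere⊆ N∣y? i∈I)))
    where
    N∣y? = λ i → N ∣? toℕ (y i)
    I = firstWhere N∣y? N

  -- S′ is a sum 2q·v with one term v reweighted by t ≡ 1 − 2q (mod N), so S′ ≡ (2q + t − 1)·v ≡ 0.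
  odd-correction : ∀ q v S′ → S′ + v ≡ q * (2 * v) + (2 * q * pred N + 1) % N * v → N ∣ S′
  odd-correction q v S′ reweighted = ∣m+n∣m⇒∣n (divides (2 * q * v) key) (n∣m*n (t / N * v))
    where
    open ≡-Reasoning
    t = 2 * q * pred N + 1
    key : t / N * v * N + S′ ≡ 2 * q * v * N
    key = +-cancelʳ-≡ v _ _ (begin
      t / N * v * N + S′ + v                  ≡⟨ L₁ (t / N) v N S′ ⟩
      S′ + v + t / N * N * v                  ≡⟨ cong (_+ t / N * N * v) reweighted ⟩
      q * (2 * v) + t % N * v + t / N * N * v ≡⟨ L₂ (q * (2 * v)) (t % N) (t / N * N) v ⟩
      q * (2 * v) + (t % N + t / N * N) * v   ≡⟨ cong (λ r → q * (2 * v) + r * v) (m≡m%n+[m/n]*n t N) ⟨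
      q * (2 * v) + t * v                     ≡⟨ L₃ q v (pred N) ⟩
      2 * q * v * suc (pred N) + v            ≡⟨ cong (λ n → 2 * q * v * n + v) (suc-pred N) ⟩
      2 * q * v * N + v                       ∎)
      where
      L₁ : ∀ x d n S → x * d * n + S + d ≡ S + d + x * n * d
      L₁ = solve-∀
      L₂ : ∀ S a b d → S + a * d + b * d ≡ S + (a + b) * d
      L₂ = solve-∀
      L₃ : ∀ q d m → q * (2 * d) + (2 * q * m + 1) * d ≡ 2 * q * d * suc m + d
      L₃ = solve-∀

  zeroSum-one-weight : ∀ {k} (y : Seq N k) (I : Subset k) {i₀} → i₀ ∈ I → ∣ I ∣ ≡ N →
    2 * toℕ (y i₀) ∣ sumOver I (toℕ ∘ y) → HasUZS N y
  zeroSum-one-weight {k} y I {i₀} i₀∈I ∣I∣≡N (divides q S≡) =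
    zeroSum y I a ∣I∣≡N (odd-correction q (toℕ (y i₀)) _ reweighted)
    where
    t = 2 * q * pred N + 1
    2∤t : 2 ∤ t
    2∤t 2∣t = 2∤1 (∣m+n∣m⇒∣n 2∣t (∣m⇒∣m*n (pred N) (m∣m*n q)))
    a : Fin k → U N
    a i with i ≟ᶠ i₀
    ... | yes _ = unit t 2∤t
    ... | no  _ = one
    a-elsewhere : ∀ i → i ≢ i₀ → toℕ (proj₁ (a i)) * toℕ (y i) ≡ toℕ (y i)
    a-elsewhere i i≢i₀ with i ≟ᶠ i₀
    ... | yes i≡i₀ = contradiction i≡i₀ i≢i₀
    ... | no  _    = trans (cong (_* toℕ (y i)) toℕ-one) (*-identityˡ (toℕ (y i)))
    a-at-i₀ : toℕ (proj₁ (a i₀)) ≡ t % N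
    a-at-i₀ with i₀ ≟ᶠ i₀
    ... | yes _     = toℕ-unit t 2∤t
    ... | no  i₀≢i₀ = contradiction refl i₀≢i₀
    reweighted : sumOver I (λ i → toℕ (proj₁ (a i)) * toℕ (y i)) + toℕ (y i₀)
               ≡ q * (2 * toℕ (y i₀)) + t % N * toℕ (y i₀)
    reweighted = trans (sumOver-update I i₀∈I a-elsewhere)
                       (cong₂ (λ S w → S + w * toℕ (y i₀)) S≡ a-at-i₀)

  zeroSum-pairs : ∀ {k} (y : Seq N k) w {A B} → 2 ∣ A → 1 ≤ A → A ≤ count y (2 ^ w) →
    B ≤ divisibleCount y (suc w) → A + B ≡ N → HasUZS N y
  zeroSum-pairs y w {A} {B} (divides h A≡h*2) 1≤A A≤c B≤c A+B≡N =
    zeroSum-one-weight y (P ∪ Q) (x∈p∪q⁺ (inj₁ (proj₂ P-nonempty))) ∣P∪Q∣≡N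
      (subst (λ v → 2 * v ∣ sumOver (P ∪ Q) (toℕ ∘ y)) (sym (firstWhere⊆ y≡2^w? (proj₂ P-nonempty)))
        (subst (2 ^ suc w ∣_) (sym (sumOver-∪ P Q (toℕ ∘ y) disjoint)) (∣m∣n⇒∣m+n 2^[1+w]∣ΣP 2^[1+w]∣ΣQ)))
    where
    y≡2^w? = λ i → toℕ (y i) ≟ 2 ^ w
    2^[1+w]∣y? = λ i → 2 ^ suc w ∣? toℕ (y i)
    P = firstWhere y≡2^w? A
    Q = firstWhere 2^[1+w]∣y? B
    ∣P∣≡A : ∣ P ∣ ≡ A
    ∣P∣≡A = ∣firstWhere∣ y≡2^w? (subst (A ≤_) (count≡countWhere y (2 ^ w)) A≤c)
    disjoint : Disjoint P Q
    disjoint i∈P i∈Q = 1+n≰n (2^∣2^⇒≤ (suc w) w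
      (subst (2 ^ suc w ∣_) (firstWhere⊆ y≡2^w? i∈P) (firstWhere⊆ 2^[1+w]∣y? i∈Q)))
    ∣P∪Q∣≡N : ∣ P ∪ Q ∣ ≡ N
    ∣P∪Q∣≡N = trans (∣p∪q∣≡∣p∣+∣q∣ P Q disjoint)
                    (trans (cong₂ _+_ ∣P∣≡A (∣firstWhere∣ 2^[1+w]∣y? B≤c)) A+B≡N)
    P-nonempty : Nonempty P
    P-nonempty = nonempty P (subst (1 ≤_) (sym ∣P∣≡A) 1≤A)
    2^[1+w]∣ΣP : 2 ^ suc w ∣ sumOver P (toℕ ∘ y)
    2^[1+w]∣ΣP = divides h (begin
      sumOver P (toℕ ∘ y) ≡⟨ sumOver-const P (λ i → firstWhere⊆ y≡2^w?) ⟩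
      ∣ P ∣ * 2 ^ w       ≡⟨ cong (_* 2 ^ w) (trans ∣P∣≡A A≡h*2) ⟩
      h * 2 * 2 ^ w       ≡⟨ *-assoc h 2 (2 ^ w) ⟩
      h * 2 ^ suc w       ∎)
      where open ≡-Reasoning
    2^[1+w]∣ΣQ : 2 ^ suc w ∣ sumOver Q (toℕ ∘ y)
    2^[1+w]∣ΣQ = ∣-sumOver Q (λ i → firstWhere⊆ 2^[1+w]∣y?)

  multiples-bound : ∀ {k} (y : Seq N k) → ¬ HasUZS N y → divisibleCount y (suc s) < N
  multiples-bound y free = ≰⇒> (free ∘ zeroSum-multiples y)

  pairs-bound : ∀ {k} (y : Seq N k) → ¬ HasUZS N y → ∀ w A → 2 ∣ A → 1 ≤ A → A ≤ count y (2 ^ w) →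
    A + divisibleCount y (suc w) < N
  pairs-bound y free w A 2∣A 1≤A A≤c with N ≤? A
  ... | yes N≤A = contradiction
    (zeroSum-pairs y w (2∣2^suc s) (<⇒≤ 1<N) (≤-trans N≤A A≤c) z≤n (+-identityʳ N)) free
  ... | no  N≰A = ≰⇒> λ N≤A+H →
    free (zeroSum-pairs y w 2∣A 1≤A A≤c (m≤n+o⇒m∸n≤o N A N≤A+H) (m+[n∸m]≡n (<⇒≤ (≰⇒> N≰A))))

  profile⇒normalForm : ∀ {k} (y : Seq N k) → (∀ i → ZeroOrPowerOfTwo s (toℕ (y i))) →
    (∀ u → u < s → count y (2 ^ u) ≡ 1) × 2 ∤ count y (2 ^ s) × count y (2 ^ s) < N →
    IsNormalForm (suc s) y
  profile⇒normalForm y y-form (ones , c-odd , c<N) =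
    ones-up-to-pred s (λ w → count y (2 ^ w)) ones c-odd c<N ,
    (count y (2 ^ s) , odd⇒2h+1 c-odd , odd⇒≥1 c-odd ,
     m+n≤o⇒m≤o∸n (count y (2 ^ s)) (subst (_≤ N) (+-comm 1 (count y (2 ^ s))) c<N) , refl) ,
    y-form

  normalForm : ∀ {k} (y : Seq N k) → (∀ i → ZeroOrPowerOfTwo s (toℕ (y i))) → ¬ HasUZS N y →
    N + s ≤ k → IsNormalForm (suc s) y
  normalForm y y-form y-free N+s≤k = profile⇒normalForm y y-form
    (LevelCounts.profile (λ w → count y (2 ^ w)) (divisibleCount y) (2∣2^suc s)
      (divisibleCount-step s y y-form) (divisibleCount-zero y) N+s≤k
      (multiples-bound y y-free) (pairs-bound y y-free))

mainTheorem7 : (r : ℕ) → 1 ≤ r → ∀ {k} (x : Seq (2 ^ r) k) →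
    IsExtremalU (2 ^ r) x →
    Σ[ y ∈ Seq (2 ^ r) k ] (UEquiv (2 ^ r) x y × IsNormalForm r y)
mainTheorem7 (suc s) _ {k} x (isE , x-free) =
  let (a , y , ax≡y , y-form) = normaliseSeq x
  in y , UEquiv-by-units x y a ax≡y ,
     normalForm y y-form (x-free ∘ transfer x y a ax≡y) (E-lower-bound k (proj₁ (proj₂ isE)))
  where open PowerOfTwoModulus s
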